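{- Let $G$ be a graph that admits a sparse edge clique cover, and let $\mathcal{C}=\{C_1,\ldots,C_k\}$ be a sparse edge clique cover of $G$. Then $\chi_i(G^{\mathcal{C}})\le \chi(G)$.
   Context: All graphs are finite and simple. A collection $\mathcal{C}=\{C_1,\ldots,C_k\}$ of cliques of $G$ is an edge clique cover of $G$ if every edge of $G$ belongs to some $C_i$; it is sparse if every vertex of $G$ belongs to at most two cliques of $\mathcal{C}$. Given a sparse edge clique cover $\mathcal{C}$, the graph $G^{\mathcal{C}}$ is defined as follows: its vertex set is the disjoint union of the vertex sets of the cliques $C_1,\ldots,C_k$ (so a vertex $x$ of $G$ lying in $C_i$ and $C_j$ gives two distinct vertices $x_i$ and $x_j$, and $|V(G^{\mathcal{C}})|=\sum_{i=1}^k |V(C_i)|$); two vertices of $G^{\mathcal{C}}$ are adjacent if they are distinct vertices of the same clique $C_i$, or if they are the two copies $x_i,x_j$ of the same vertex $x$ of $G$ lying in two cliques $C_i,C_j$. $\chi(G)$ is the chromatic number. An injective $k$-coloring of a graph is a map $f:V\to\{1,\dots,k\}$ such that no vertex has two neighbors $u\neq w$ with $f(u)=f(w)$; the injective chromatic number $\chi_i$ is the least $k$ admitting an injective $k$-coloring. -}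

module Defs where

open import Data.Nat using (ℕ; _≤_)
open import Data.Fin using (Fin)
open import Data.Bool using (Bool; T)
open import Data.Product using (Σ; ∃; _×_; _,_)
open import Data.Sum using (_⊎_; inj₁; inj₂)
open import Data.Empty using (⊥)
open import Relation.Nullary using (¬_)
open import Relation.Binary.PropositionalEquality using (_≡_; _≢_; refl; sym)

record Graph (V : Set) : Set₁ where
  field
    Adj    : V → V → Set
    symm   : ∀ {u v} → Adj u v → Adj v u
    irrefl : ∀ v → ¬ Adj v v
open Graph public

IsProperColoring : ∀ {V} (G : Graph V) (k : ℕ) → (V → Fin k) → Set
IsProperColoring G k f = ∀ u v → Adj G u v → f u ≢ f v

HasProperColoring : ∀ {V} → Graph V → ℕ → Set
HasProperColoring {V} G k = Σ (V → Fin k) (IsProperColoring G k)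

IsChromaticNumber : ∀ {V} → Graph V → ℕ → Set
IsChromaticNumber G k = HasProperColoring G k × (∀ m → HasProperColoring G m → k ≤ m)

IsInjectiveColoring : ∀ {V} (G : Graph V) (k : ℕ) → (V → Fin k) → Set
IsInjectiveColoring {V} G k f =
  ∀ (v u w : V) → Adj G v u → Adj G v w → u ≢ w → f u ≢ f w

HasInjectiveColoring : ∀ {V} → Graph V → ℕ → Set
HasInjectiveColoring {V} G k = Σ (V → Fin k) (IsInjectiveColoring G k)

IsInjectiveChromaticNumber : ∀ {V} → Graph V → ℕ → Set
IsInjectiveChromaticNumber G k =
  HasInjectiveColoring G k × (∀ m → HasInjectiveColoring G m → k ≤ m)

Family : ℕ → ℕ → Set
Family n k = Fin k → Fin n → Bool

_∈C_ : ∀ {n} → Fin n → (Fin n → Bool) → Set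
x ∈C S = T (S x)

IsClique : ∀ {n} → Graph (Fin n) → (Fin n → Bool) → Set
IsClique G S = ∀ x y → x ∈C S → y ∈C S → x ≢ y → Adj G x y

IsEdgeCliqueCover : ∀ {n k} → Graph (Fin n) → Family n k → Set
IsEdgeCliqueCover {n} {k} G C =
  (∀ (i : Fin k) → IsClique G (C i)) ×
  (∀ x y → Adj G x y → ∃ λ (i : Fin k) → x ∈C C i × y ∈C C i)

-- every vertex lies in at most two of the cliques
IsSparse : ∀ {n k} → Family n k → Set
IsSparse {n} {k} C =
  ∀ (x : Fin n) (i j l : Fin k) → x ∈C C i → x ∈C C j → x ∈C C l →
  i ≡ j ⊎ i ≡ l ⊎ j ≡ l

IsSparseEdgeCliqueCover : ∀ {n k} → Graph (Fin n) → Family n k → Set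
IsSparseEdgeCliqueCover G C = IsEdgeCliqueCover G C × IsSparse C

-- G^C: vertices are pairs (i , x) with x ∈ C_i (disjoint union of the cliques)
VC : ∀ {n k} → Family n k → Set
VC {n} {k} C = Σ (Fin k × Fin n) λ { (i , x) → x ∈C C i }

AdjC : ∀ {n k} (C : Family n k) → VC C → VC C → Set
AdjC C ((i , x) , _) ((j , y) , _) = (i ≡ j × x ≢ y) ⊎ (x ≡ y × i ≢ j)

GC : ∀ {n k} (C : Family n k) → Graph (VC C)
GC C = record { Adj = AdjC C ; symm = λ {u} {v} → s {u} {v} ; irrefl = ir }
  where
  s : ∀ {u v} → AdjC C u v → AdjC C v u
  s {(i , x) , _} {(j , y) , _} (inj₁ (p , q)) = inj₁ (sym p , λ e → q (sym e))
  s {(i , x) , _} {(j , y) , _} (inj₂ (p , q)) = inj₂ (sym p , λ e → q (sym e))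
  ir : ∀ v → ¬ AdjC C v v
  ir v (inj₁ (_ , q)) = q refl
  ir v (inj₂ (_ , q)) = q refl

-- Colour the copy x_i of a vertex x by the colour of x in an optimal proper colouring
-- of G. Two distinct neighbours of a vertex of G^C are either two vertices of one
-- clique, or a vertex of a clique together with another copy of a vertex of that
-- clique; in both cases their originals are adjacent in G, so they get different
-- colours. Two distinct copies of x cannot both neighbour a third copy of x, since x
-- lies in at most two cliques.
module Submission where

open import Defs
open import Data.Nat using (ℕ; _≤_)
open import Data.Fin using (Fin)
open import Data.Bool.Properties using (T-irrelevant)
open import Data.Product using (_,_)
open import Data.Sum using (inj₁; inj₂)
open import Data.Empty using (⊥-elim)
open import Function using (_∘_)
open import Relation.Binary.PropositionalEquality using (_≡_; _≢_; refl; sym; cong)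

original : ∀ {n k} {C : Family n k} → VC C → Fin n
original ((_ , x) , _) = x

VC-≡ : ∀ {n k} {C : Family n k} {i j : Fin k} {x y : Fin n}
       (p : x ∈C C i) (q : y ∈C C j) →
       i ≡ j → x ≡ y → _≡_ {A = VC C} ((i , x) , p) ((j , y) , q)
VC-≡ p q refl refl = cong (λ r → (_ , r)) (T-irrelevant p q)

IsCliqueFamily : ∀ {n k} → Graph (Fin n) → Family n k → Set
IsCliqueFamily {k = k} G C = ∀ (i : Fin k) → IsClique G (C i)

distinct-neighbours-have-adjacent-originals :
  ∀ {n k} {G : Graph (Fin n)} {C : Family n k} →
  IsCliqueFamily G C → IsSparse C →
  ∀ (v u w : VC C) → AdjC C v u → AdjC C v w → u ≢ w →
  Adj G (original u) (original w)
distinct-neighbours-have-adjacent-originals {G = G} {C = C} cliques sparse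
  ((i , x) , px) ((j , y) , py) ((l , z) , pz) = neighbours
  where
  neighbours : AdjC C ((i , x) , px) ((j , y) , py) → AdjC C ((i , x) , px) ((l , z) , pz) →
               ((j , y) , py) ≢ ((l , z) , pz) → Adj G y z
  neighbours (inj₁ (refl , _)) (inj₁ (refl , _)) u≢w =
    cliques i y z py pz (λ y≡z → u≢w (VC-≡ py pz refl y≡z))
  neighbours (inj₁ (refl , x≢y)) (inj₂ (refl , _)) _ = cliques i y x py px (x≢y ∘ sym)
  neighbours (inj₂ (refl , _)) (inj₁ (refl , x≢z)) _ = cliques i x z px pz x≢z
  neighbours (inj₂ (refl , i≢j)) (inj₂ (refl , i≢l)) u≢w with sparse x i j l px py pz
  ... | inj₁ i≡j        = ⊥-elim (i≢j i≡j)
  ... | inj₂ (inj₁ i≡l) = ⊥-elim (i≢l i≡l)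
  ... | inj₂ (inj₂ j≡l) = ⊥-elim (u≢w (VC-≡ py pz j≡l refl))

proper∘projection-isInjective :
  ∀ {V W} {G : Graph V} {H : Graph W} {k} (π : W → V) →
  (∀ v u w → Adj H v u → Adj H v w → u ≢ w → Adj G (π u) (π w)) →
  (f : V → Fin k) → IsProperColoring G k f → IsInjectiveColoring H k (f ∘ π)
proper∘projection-isInjective π project f proper v u w vu vw u≢w =
  proper (π u) (π w) (project v u w vu vw u≢w)

lemma2p1 : ∀ {n k : ℕ} (G : Graph (Fin n)) (C : Family n k) →
           IsSparseEdgeCliqueCover G C →
           ∀ (a b : ℕ) → IsChromaticNumber G a →
           IsInjectiveChromaticNumber (GC C) b → b ≤ a
lemma2p1 G C ((cliques , _) , sparse) a b ((f , proper) , _) (_ , b-minimal) =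
  b-minimal a (f ∘ original , injective)
  where
  injective : IsInjectiveColoring (GC C) a (f ∘ original)
  injective = proper∘projection-isInjective {G = G} {H = GC C} original
                (distinct-neighbours-have-adjacent-originals {G = G} cliques sparse) f proper
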